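{- Let $Y$ be a finite connected vertex-transitive graph whose induced neighbourhoods are asymmetric, let $u$ be a vertex of $Y$, let $X=\langle N(u,Y)\rangle$, and let $S$ be an orbit-restrictor in $X$ with $v\in S$. Let $\alpha$ be the (unique) automorphism of $Y$ with $\alpha(u)=v$. Then the $\alpha$-orbit of $u$ is contained in $\{u\}\cup S$ (it contains $u$, $v$ and a subset of the other vertices of $S$), and $\alpha(\{u\}\cup S)=\{u\}\cup S$.
   Context: All graphs are simple. $N(v,X)$ is the set of neighbours of $v$ in $X$ and $\langle N(v,X)\rangle$ the induced subgraph on it; a graph is asymmetric if its only automorphism is the identity. For a graph $X$, $[v]=\{w\in V(X):\langle N(w,X)\rangle\cong\langle N(v,X)\rangle\}$. A clique $S$ in $X$ is an orbit-restrictor if for every $v\in S$: (i) $[v]\subseteq S$; and (ii) for all $v_1,v_2\in[v]$ (not necessarily distinct) and every isomorphism $\phi:\langle N(v_1,X)\rangle\to\langle N(v_2,X)\rangle$, one has $\phi(S\setminus\{v_1\})=S\setminus\{v_2\}$. -}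

module Defs where

open import Data.Nat using (ℕ)
open import Data.Bool using (Bool; true; false; T)
open import Data.Fin using (Fin)
open import Data.Product using (Σ; _×_; _,_; proj₁; proj₂)
open import Data.Sum using (_⊎_)
open import Relation.Binary.PropositionalEquality using (_≡_; _≢_)
open import Relation.Nullary using (¬_)
open import Function.Bundles using (_↔_)
open import Function using (id)

record Graph : Set₁ where
  field
    V      : Set
    E      : V → V → Bool
    sym    : ∀ a b → E a b ≡ E b a
    irrefl : ∀ a → E a a ≡ false
open Graph public

Finite : Graph → Set
Finite G = Σ ℕ λ n → V G ↔ Fin n

Induced : (G : Graph) → (V G → Bool) → Graph
Induced G P = record
  { V      = Σ (V G) (λ x → T (P x))
  ; E      = λ a b → E G (proj₁ a) (proj₁ b)
  ; sym    = λ a b → sym G (proj₁ a) (proj₁ b)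
  ; irrefl = λ a → irrefl G (proj₁ a)
  }

Nbhd : (G : Graph) → V G → Graph
Nbhd G v = Induced G (E G v)

record Iso (G H : Graph) : Set where
  field
    to      : V G → V H
    from    : V H → V G
    from∘to : ∀ a → from (to a) ≡ a
    to∘from : ∀ b → to (from b) ≡ b
    pres    : ∀ a b → E H (to a) (to b) ≡ E G a b
open Iso public

Aut : Graph → Set
Aut G = Iso G G

Asymmetric : Graph → Set
Asymmetric G = (φ : Aut G) → ∀ x → to φ x ≡ x

data Reach (G : Graph) : V G → V G → Set where
  here : ∀ {a} → Reach G a a
  step : ∀ {a b c} → E G a b ≡ true → Reach G b c → Reach G a c

Connected : Graph → Set
Connected G = ∀ a b → Reach G a b

VertexTransitive : Graph → Set
VertexTransitive G = ∀ a b → Σ (Aut G) λ α → to α a ≡ b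

-- Membership of w in [v] (computed in G): ⟨N(w,G)⟩ ≅ ⟨N(v,G)⟩.
InClass : (G : Graph) → V G → V G → Set
InClass G v w = Iso (Nbhd G w) (Nbhd G v)

Clique : (G : Graph) → (V G → Set) → Set
Clique G S = ∀ a b → S a → S b → a ≢ b → E G a b ≡ true

-- φ(S ∖ {v₁}) = S ∖ {v₂}, with φ : ⟨N(v₁,G)⟩ → ⟨N(v₂,G)⟩ (image as a set of vertices of G).
ImageEq : (G : Graph) (S : V G → Set) (v₁ v₂ : V G) → Iso (Nbhd G v₁) (Nbhd G v₂) → Set
ImageEq G S v₁ v₂ φ =
  (∀ (x : V (Nbhd G v₁)) → S (proj₁ x) → proj₁ x ≢ v₁ →
     S (proj₁ (to φ x)) × proj₁ (to φ x) ≢ v₂)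
  × (∀ (y : V G) → S y → y ≢ v₂ →
     Σ (V (Nbhd G v₁)) λ x → S (proj₁ x) × proj₁ x ≢ v₁ × proj₁ (to φ x) ≡ y)

OrbitRestrictor : (G : Graph) → (V G → Set) → Set
OrbitRestrictor G S =
  Clique G S ×
  (∀ v → S v →
     (∀ w → InClass G v w → S w) ×
     (∀ v₁ v₂ → InClass G v v₁ → InClass G v v₂ →
        (φ : Iso (Nbhd G v₁) (Nbhd G v₂)) → ImageEq G S v₁ v₂ φ))

iter : {A : Set} → (A → A) → ℕ → A → A
iter f ℕ.zero x = x
iter f (ℕ.suc k) x = f (iter f k x)

-- {u} ∪ S, where S is a set of vertices of X = ⟨N(u,Y)⟩ (viewed inside V(Y)).
InUS : (Y : Graph) (u : V Y) (S : V (Nbhd Y u) → Set) → V Y → Set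
InUS Y u S y = y ≡ u ⊎ Σ (V (Nbhd Y u)) λ x → S x × proj₁ x ≡ y

-- α⁻¹(u) is a neighbour of u, and α maps the common neighbours of u and α⁻¹(u)
-- onto the common neighbours of v and u, so it restricts to an isomorphism
-- φ : ⟨N(α⁻¹(u), X)⟩ → ⟨N(v, X)⟩. Hence α⁻¹(u) ∈ [v] ⊆ S, and condition (ii) for φ
-- says that α maps S ∖ {α⁻¹(u)} onto S ∖ {v}. Together with α⁻¹(u) ↦ u and u ↦ v,
-- α permutes {u} ∪ S, which then contains the whole α-orbit of u.
module Submission where

open import Defs
open import Data.Nat using (ℕ; zero; suc)
open import Data.Bool using (Bool; T)
open import Data.Bool.Properties using (T-irrelevant; T-≡)
open import Data.Product using (Σ; _×_; _,_; proj₁; proj₂)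
open import Data.Product.Properties using (Σ-≡,≡→≡)
open import Data.Sum using (inj₁; inj₂)
open import Data.Fin.Properties using (inj⇒≟)
open import Function.Bundles using (Equivalence)
open import Function.Properties.Inverse using (↔⇒↣)
open import Relation.Nullary using (yes; no)
open import Relation.Nullary.Decidable using (map′)
open import Relation.Binary.Definitions using (DecidableEquality)
open import Relation.Binary.PropositionalEquality
  using (_≡_; refl; subst; cong; trans; ≢-sym)
  renaming (sym to ≡-sym)

private
  variable
    G H K : Graph

Induced-≡ : (G : Graph) (P : V G → Bool) {a b : V (Induced G P)} → proj₁ a ≡ proj₁ b → a ≡ b
Induced-≡ G P refl = Σ-≡,≡→≡ (refl , T-irrelevant _ _)

Induced-≟ : (G : Graph) → DecidableEquality (V G) → (P : V G → Bool) →
            DecidableEquality (V (Induced G P))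
Induced-≟ G _≟_ P a b = map′ (Induced-≡ G P) (cong proj₁) (proj₁ a ≟ proj₁ b)

Finite⇒≟ : (G : Graph) → Finite G → DecidableEquality (V G)
Finite⇒≟ G (_ , bij) = inj⇒≟ (↔⇒↣ bij)

Iso-refl : Iso G G
Iso-refl = record
  { to = λ x → x ; from = λ x → x
  ; from∘to = λ _ → refl ; to∘from = λ _ → refl ; pres = λ _ _ → refl }

Iso-trans : Iso G H → Iso H K → Iso G K
Iso-trans α β = record
  { to      = λ x → to β (to α x)
  ; from    = λ z → from α (from β z)
  ; from∘to = λ x → trans (cong (from α) (from∘to β (to α x))) (from∘to α x)
  ; to∘from = λ z → trans (cong (to β) (to∘from α (from β z))) (to∘from β z)
  ; pres    = λ x y → trans (pres β (to α x) (to α y)) (pres α x y)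
  }

pres-along : (α : Iso G H) {a b : V G} {c d : V H} →
             to α a ≡ c → to α b ≡ d → E H c d ≡ E G a b
pres-along α refl refl = pres α _ _

Induced-Iso : (α : Iso G H) {P : V G → Bool} {Q : V H → Bool} →
              (∀ x → P x ≡ Q (to α x)) → Iso (Induced G P) (Induced H Q)
Induced-Iso {G} {H} α {P} {Q} P≡Q∘α = record
  { to      = λ (x , p) → to α x , subst T (P≡Q∘α x) p
  ; from    = λ (y , q) → from α y , subst T (Q≡P∘α⁻¹ y) q
  ; from∘to = λ a → Induced-≡ G P (from∘to α (proj₁ a))
  ; to∘from = λ b → Induced-≡ H Q (to∘from α (proj₁ b))
  ; pres    = λ a b → pres α (proj₁ a) (proj₁ b)
  }
  where
  Q≡P∘α⁻¹ : ∀ y → Q y ≡ P (from α y)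
  Q≡P∘α⁻¹ y = trans (cong Q (≡-sym (to∘from α y))) (≡-sym (P≡Q∘α (from α y)))

Nbhd-Iso : (α : Iso G H) (a : V G) {b : V H} → to α a ≡ b → Iso (Nbhd G a) (Nbhd H b)
Nbhd-Iso α a αa≡b = Induced-Iso α (λ x → ≡-sym (pres-along α αa≡b refl))

Nbhd-swap : (G : Graph) (a b : V G) (ab : T (E G a b)) (ba : T (E G b a)) →
            Iso (Nbhd (Nbhd G a) (b , ab)) (Nbhd (Nbhd G b) (a , ba))
Nbhd-swap G a b ab ba = record
  { to      = λ ((x , ax) , bx) → (x , bx) , ax
  ; from    = λ ((x , bx) , ax) → (x , ax) , bx
  ; from∘to = λ _ → refl
  ; to∘from = λ _ → refl
  ; pres    = λ _ _ → refl
  }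

iter-preserves : {A : Set} {P : A → Set} (f : A → A) → (∀ x → P x → P (f x)) →
                 ∀ {x} → P x → ∀ k → P (iter f k x)
iter-preserves f pres-P Px zero    = Px
iter-preserves f pres-P Px (suc k) = pres-P _ (iter-preserves f pres-P Px k)

module OrbitRestrictorStep
  (Y : Graph) (_≟_ : DecidableEquality (V Y))
  (u : V Y) (S : V (Nbhd Y u) → Set) (OR : OrbitRestrictor (Nbhd Y u) S)
  (v : V (Nbhd Y u)) (Sv : S v) (α : Aut Y) (αu≡v : to α u ≡ proj₁ v) where

  private
    X : Graph
    X = Nbhd Y u

    α⁻¹u∼u : T (E Y (from α u) u)
    α⁻¹u∼u = subst T (pres-along α (to∘from α u) αu≡v) (proj₂ v)

  u⁻ : V X
  u⁻ = from α u , subst T (sym Y (from α u) u) α⁻¹u∼u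

  -- α maps ⟨N(α⁻¹u, Y)⟩ onto ⟨N(u, Y)⟩ = X; the swap first moves the condition
  -- "adjacent to u" inside, so that α turns it into "adjacent to v".
  φ : Iso (Nbhd X u⁻) (Nbhd X v)
  φ = Iso-trans (Nbhd-swap Y u (from α u) (proj₂ u⁻) α⁻¹u∼u)
                (Nbhd-Iso α↾N[α⁻¹u] (u , α⁻¹u∼u) {v} (Induced-≡ Y (E Y u) αu≡v))
    where
    α↾N[α⁻¹u] : Iso (Nbhd Y (from α u)) X
    α↾N[α⁻¹u] = Nbhd-Iso α (from α u) (to∘from α u)

  S-u⁻ : S u⁻
  S-u⁻ = proj₁ (proj₂ OR v Sv) u⁻ φ

  φ-image : ImageEq X S u⁻ v φ
  φ-image = proj₂ (proj₂ OR v Sv) u⁻ v φ Iso-refl φ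

  α-preserves-InUS : ∀ y → InUS Y u S y → InUS Y u S (to α y)
  α-preserves-InUS _ (inj₁ refl)            = inj₂ (v , Sv , ≡-sym αu≡v)
  α-preserves-InUS _ (inj₂ (x , Sx , refl)) with Induced-≟ Y _≟_ (E Y u) x u⁻
  ... | yes refl = inj₁ (to∘from α u)
  ... | no x≢u⁻  = inj₂ (proj₁ (to φ x∈N[u⁻]) , proj₁ (proj₁ φ-image x∈N[u⁻] Sx x≢u⁻) , refl)
    where
    x∈N[u⁻] : V (Nbhd X u⁻)
    x∈N[u⁻] = x , Equivalence.from T-≡ (proj₁ OR u⁻ x S-u⁻ Sx (≢-sym x≢u⁻))

  α-onto-InUS : ∀ z → InUS Y u S z → Σ (V Y) λ y → InUS Y u S y × to α y ≡ z
  α-onto-InUS _ (inj₁ refl)            = from α u , inj₂ (u⁻ , S-u⁻ , refl) , to∘from α u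
  α-onto-InUS _ (inj₂ (x , Sx , refl)) with Induced-≟ Y _≟_ (E Y u) x v
  ... | yes refl = u , inj₁ refl , αu≡v
  ... | no x≢v   with proj₂ φ-image x Sx x≢v
  ...   | w , Sw , _ , φw≡x = proj₁ (proj₁ w) , inj₂ (proj₁ w , Sw , refl) , cong proj₁ φw≡x

-- Connectedness, vertex-transitivity and asymmetry only serve, in the paper, to make α
-- unique; here α is given. Finiteness is used only for decidable equality of vertices.
lemma2p5 : (Y : Graph) → Finite Y → Connected Y → VertexTransitive Y →
           (∀ w → Asymmetric (Nbhd Y w)) →
           (u : V Y) (S : V (Nbhd Y u) → Set) → OrbitRestrictor (Nbhd Y u) S →
           (v : V (Nbhd Y u)) → S v →
           (α : Aut Y) → to α u ≡ proj₁ v →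
           (∀ (k : ℕ) → InUS Y u S (iter (to α) k u))
           × (∀ y → InUS Y u S y → InUS Y u S (to α y))
           × (∀ z → InUS Y u S z → Σ (V Y) λ y → InUS Y u S y × to α y ≡ z)
lemma2p5 Y fin _ _ _ u S OR v Sv α αu≡v =
  iter-preserves (to α) α-preserves-InUS (inj₁ refl) , α-preserves-InUS , α-onto-InUS
  where open OrbitRestrictorStep Y (Finite⇒≟ Y fin) u S OR v Sv α αu≡v
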